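{- Let $I$ and $I'$ be input streams such that $I'$ is a subsequence of $I$. Then $\mathrm{OPT}(I')\le\mathrm{OPT}(I)$.
   Context: Up-down run generation problem: an input stream $I$ of elements from a totally ordered set is presented in order to an algorithm with a buffer of $M$ slots; the algorithm reads elements in order into the buffer and writes elements from the buffer to an output sequence $S$ (the algorithm is allowed to leave buffer slots free). A run is a sorted or reverse-sorted sequence; $R(S)$ is the smallest $k$ such that $S$ is a concatenation of $k$ runs; $\mathrm{OPT}(I)$ is the minimum of $R(S)$ over all outputs achievable on $I$ with buffer size $M$. A subsequence of $a_1,\dots,a_k$ is a sequence $a_{n_1},\dots,a_{n_\ell}$ with $1\le n_1<\dots<n_\ell\le k$. -}

module Defs where

open import Level using (Level; _⊔_; suc)
open import Data.Nat using (ℕ; _<_; _≤_)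
open import Data.List using (List; []; _∷_; _++_; length; concat)
open import Data.List.Relation.Unary.All using (All)
open import Data.List.Relation.Unary.Linked using (Linked)
open import Data.Product using (Σ; _×_; ∃)
open import Data.Sum using (_⊎_)
open import Function using (flip)
open import Relation.Binary.PropositionalEquality using (_≡_)
open import Relation.Binary.Bundles using (TotalOrder)

module UpDown {a ℓ₁ ℓ₂ : Level} (O : TotalOrder a ℓ₁ ℓ₂) where
  open TotalOrder O using () renaming (Carrier to A; _≤_ to _≼_)

  Run : List A → Set (a ⊔ ℓ₂)
  Run xs = Linked _≼_ xs ⊎ Linked (flip _≼_) xs

  ConcatOfRuns : ℕ → List A → Set (a ⊔ ℓ₂)
  ConcatOfRuns k S = Σ (List (List A)) λ rs →
    length rs ≡ k × concat rs ≡ S × All Run rs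

  IsR : List A → ℕ → Set (a ⊔ ℓ₂)
  IsR S n = ConcatOfRuns n S × (∀ k → ConcatOfRuns k S → n ≤ k)

  -- Gen M I B S: starting with remaining input I and buffer contents B
  -- (at most M slots used), the algorithm can write exactly the output S
  -- (and finish with empty input and empty buffer).
  data Gen (M : ℕ) : List A → List A → List A → Set a where
    done  : Gen M [] [] []
    read  : ∀ {x I B S} → length B < M →
            Gen M I (x ∷ B) S → Gen M (x ∷ I) B S
    write : ∀ {x I B₁ B₂ S} →
            Gen M I (B₁ ++ B₂) S → Gen M I (B₁ ++ x ∷ B₂) (x ∷ S)

  Achievable : ℕ → List A → List A → Set a
  Achievable M I S = Gen M I [] S

  IsOPT : ℕ → List A → ℕ → Set (a ⊔ ℓ₂)
  IsOPT M I n = (∃ λ S → Achievable M I S × IsR S n)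
              × (∀ S k → Achievable M I S → IsR S k → n ≤ k)

module Submission where

open import Defs
open import Level using (Level)
open import Data.Nat using (ℕ; suc; _≤_; _<_; s≤s; _≤?_)
open import Data.Nat.Properties using (≤-trans; <-≤-trans; ≮⇒≥)
open import Data.Nat.Induction using (<-rec)
open import Data.List using (List; []; _∷_; _++_; length; concat)
open import Data.List.Relation.Binary.Sublist.Propositional using (_⊆_; _⊇_; []; _∷_; _∷ʳ_)
open import Data.List.Relation.Binary.Sublist.Propositional.Properties using (++⁺; length-mono-≤; All-resp-⊆)
open import Data.List.Relation.Unary.All using (All; []; _∷_)
open import Data.List.Relation.Unary.AllPairs using (AllPairs; []; _∷_)
open import Data.List.Relation.Unary.Linked using (Linked)
open import Data.List.Relation.Unary.Linked.Properties using (Linked⇒AllPairs; AllPairs⇒Linked)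
open import Data.Product using (_×_; ∃; ∃₂; _,_; proj₂)
open import Data.Sum using (_⊎_; inj₁; inj₂)
open import Function using (_∘_)
open import Relation.Binary.Core using (Rel)
open import Relation.Binary.Definitions using (Transitive; _Respects_)
open import Relation.Binary.PropositionalEquality using (_≡_; refl; cong)
open import Relation.Binary.Bundles using (TotalOrder)
open import Relation.Nullary using (¬_)
open import Relation.Nullary.Decidable using (decidable-stable)

-- A run of the algorithm on I can be mirrored on a subsequence I′ of I: the
-- mirror skips every read and write of an element missing from I′, so its
-- buffer is always a sublist of the original buffer and its output a sublist
-- of the original output. Sublists of runs are runs, so a decomposition of an
-- optimal output for I into n runs restricts to one of the mirrored output
-- into n (possibly empty) runs, whence OPT(I′) ≤ n.

module _ {a} {A : Set a} where

  ++-⊆-split : ∀ xs {ys zs : List A} → zs ⊆ xs ++ ys →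
               ∃₂ λ zs₁ zs₂ → zs ≡ zs₁ ++ zs₂ × zs₁ ⊆ xs × zs₂ ⊆ ys
  ++-⊆-split []       p          = [] , _ , refl , [] , p
  ++-⊆-split (x ∷ xs) (.x ∷ʳ p)  with ++-⊆-split xs p
  ... | zs₁ , zs₂ , refl , p₁ , p₂ = zs₁ , zs₂ , refl , x ∷ʳ p₁ , p₂
  ++-⊆-split (x ∷ xs) (refl ∷ p) with ++-⊆-split xs p
  ... | zs₁ , zs₂ , refl , p₁ , p₂ = x ∷ zs₁ , zs₂ , refl , refl ∷ p₁ , p₂

  ⊆-middle-split : ∀ xs {x : A} {ys zs} → zs ⊆ xs ++ x ∷ ys →
                   zs ⊆ xs ++ ys ⊎
                   ∃₂ λ zs₁ zs₂ → zs ≡ zs₁ ++ x ∷ zs₂ × zs₁ ⊆ xs × zs₂ ⊆ ys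
  ⊆-middle-split xs p with ++-⊆-split xs p
  ... | _ , _   , refl , p₁ , _ ∷ʳ p₂  = inj₁ (++⁺ p₁ p₂)
  ... | zs₁ , _ ∷ zs₂ , refl , p₁ , refl ∷ p₂ = inj₂ (zs₁ , zs₂ , refl , p₁ , p₂)

  AllPairs-resp-⊆ : ∀ {ℓ} {R : Rel A ℓ} → AllPairs R Respects _⊇_
  AllPairs-resp-⊆ []         []         = []
  AllPairs-resp-⊆ (_ ∷ʳ p)   (_ ∷ rs)   = AllPairs-resp-⊆ p rs
  AllPairs-resp-⊆ (refl ∷ p) (rx ∷ rs)  = All-resp-⊆ p rx ∷ AllPairs-resp-⊆ p rs

  Linked-resp-⊆ : ∀ {ℓ} {R : Rel A ℓ} → Transitive R → Linked R Respects _⊇_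
  Linked-resp-⊆ trans p = AllPairs⇒Linked ∘ AllPairs-resp-⊆ p ∘ Linked⇒AllPairs trans

-- Only a double-negated least element is available constructively; it suffices
-- because the goal n′ ≤ n is decidable.
¬¬-least : ∀ {p} (P : ℕ → Set p) {k} → P k →
           ¬ ¬ (∃ λ j → P j × (∀ m → P m → j ≤ m))
¬¬-least P {k} = <-rec _ step k
  where
  step : ∀ k → (∀ {m} → m < k → P m → ¬ ¬ (∃ λ j → P j × (∀ m → P m → j ≤ m))) →
         P k → ¬ ¬ (∃ λ j → P j × (∀ m → P m → j ≤ m))
  step k ih pk noLeast = noLeast (k , pk , λ m pm → ≮⇒≥ λ m<k → ih m<k pm noLeast)

module _ {a ℓ₁ ℓ₂ : Level} (O : TotalOrder a ℓ₁ ℓ₂) where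
  open TotalOrder O using (trans) renaming (Carrier to A)
  open UpDown O

  Run-resp-⊆ : Run Respects _⊇_
  Run-resp-⊆ p (inj₁ up)   = inj₁ (Linked-resp-⊆ trans p up)
  Run-resp-⊆ p (inj₂ down) = inj₂ (Linked-resp-⊆ (λ y≥x z≥y → trans z≥y y≥x) p down)

  concat-runs-⊆ : (rs : List (List A)) → All Run rs → ∀ {S′} → S′ ⊆ concat rs →
                  ConcatOfRuns (length rs) S′
  concat-runs-⊆ []       []         []  = [] , refl , refl , []
  concat-runs-⊆ (r ∷ rs) (run ∷ runs) p with ++-⊆-split r p
  ... | r′ , _ , refl , r′⊆r , p′ with concat-runs-⊆ rs runs p′
  ...   | rs′ , len , cat , runs′ =
    r′ ∷ rs′ , cong suc len , cong (r′ ++_) cat , Run-resp-⊆ r′⊆r run ∷ runs′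

  ConcatOfRuns-resp-⊆ : ∀ {k} → ConcatOfRuns k Respects _⊇_
  ConcatOfRuns-resp-⊆ p (rs , refl , refl , runs) = concat-runs-⊆ rs runs p

  Gen-restrict : ∀ {M I B S} → Gen M I B S → ∀ {I′ B′} → I′ ⊆ I → B′ ⊆ B →
                 ∃ λ S′ → Gen M I′ B′ S′ × S′ ⊆ S
  Gen-restrict done [] [] = [] , done , []
  Gen-restrict (read {x} _ g) (.x ∷ʳ I′⊆I) B′⊆B = Gen-restrict g I′⊆I (x ∷ʳ B′⊆B)
  Gen-restrict (read room g) (refl ∷ I′⊆I) B′⊆B with Gen-restrict g I′⊆I (refl ∷ B′⊆B)
  ... | S′ , g′ , S′⊆S = S′ , read (<-≤-trans (s≤s (length-mono-≤ B′⊆B)) room) g′ , S′⊆S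
  Gen-restrict (write {x} {B₁ = B₁} g) I′⊆I B′⊆B with ⊆-middle-split B₁ B′⊆B
  ... | inj₁ B′⊆B₁B₂ with Gen-restrict g I′⊆I B′⊆B₁B₂
  ...   | S′ , g′ , S′⊆S = S′ , g′ , x ∷ʳ S′⊆S
  Gen-restrict (write g) I′⊆I B′⊆B | inj₂ (_ , _ , refl , C₁⊆B₁ , C₂⊆B₂)
    with Gen-restrict g I′⊆I (++⁺ C₁⊆B₁ C₂⊆B₂)
  ... | S′ , g′ , S′⊆S = _ ∷ S′ , write g′ , refl ∷ S′⊆S

lemma1 : {a ℓ₁ ℓ₂ : Level} (O : TotalOrder a ℓ₁ ℓ₂) (M : ℕ)
    (I I′ : List (TotalOrder.Carrier O)) → I′ ⊆ I →
    (n n′ : ℕ) → UpDown.IsOPT O M I n → UpDown.IsOPT O M I′ n′ →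
    n′ ≤ n
lemma1 O M I I′ I′⊆I n n′ ((S , gen , nRuns , _) , _) (_ , optimal′)
  with Gen-restrict O gen I′⊆I []
... | S′ , gen′ , S′⊆S = decidable-stable (n′ ≤? n) λ n′≰n →
  ¬¬-least (λ k → ConcatOfRuns k S′) nRuns′ λ (j , isR) →
    n′≰n (≤-trans (optimal′ S′ j gen′ isR) (proj₂ isR n nRuns′))
  where
  open UpDown O
  nRuns′ : ConcatOfRuns n S′
  nRuns′ = ConcatOfRuns-resp-⊆ O S′⊆S nRuns
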